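{- Let $(G=(V,E),\ell,k)$ be an instance of \textsc{Colored Clustering}. Suppose some vertex $v\in V$ has chromatic degree at least $2k+1$, and let $c$ be a least frequent color among the edges incident to $v$ (i.e. a color appearing on at least one edge incident to $v$ and minimizing the number of edges incident to $v$ of that color). Let $G'$ be obtained from $G$ by deleting all edges of color $c$ incident to $v$. Then $G$ has a stable edge set of size at least $k$ if and only if $G'$ (with $\ell$ restricted to its edges) has a stable edge set of size at least $k$.
   Context: \textsc{Colored Clustering}: given a graph $G=(V,E)$, an edge coloring $\ell\colon E\to C$, and $k\in\mathbb{N}$, decide whether there is a stable $F\subseteq E$ with $|F|\ge k$; $F$ is stable if $\ell(e)=\ell(e')$ whenever $e,e'\in F$ share a vertex. The chromatic degree of $v$ is the number of distinct colors $\ell(e)$ over edges $e$ incident to $v$. -}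

module Defs where

open import Data.Nat using (ℕ; _≤_; _+_; _*_)
open import Data.Fin using (Fin)
open import Data.Fin.Subset using (Subset; _∈_; _⊆_; ∣_∣; ⊤)
open import Data.Vec using (tabulate)
open import Data.Bool using (Bool; not; _∧_)
open import Data.List using (List; length; map; filter; deduplicate; allFin)
open import Data.Product using (Σ; _×_; ∃-syntax; proj₁; proj₂)
open import Data.Sum using (_⊎_)
open import Relation.Nullary using (¬_; Dec; ⌊_⌋)
open import Relation.Nullary.Decidable using (_⊎-dec_; _×-dec_)
open import Relation.Binary.PropositionalEquality using (_≡_; _≢_)
open import Relation.Binary.Definitions using (DecidableEquality)
open import Data.Fin.Properties using (_≟_)

record Graph : Set where
  field
    n     : ℕ
    m     : ℕ
    ends  : Fin m → Fin n × Fin n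
    loopless : ∀ e → proj₁ (ends e) ≢ proj₂ (ends e)
    noParallel : ∀ e e' →
      ((proj₁ (ends e) ≡ proj₁ (ends e') × proj₂ (ends e) ≡ proj₂ (ends e')) ⊎
       (proj₁ (ends e) ≡ proj₂ (ends e') × proj₂ (ends e) ≡ proj₁ (ends e'))) →
      e ≡ e'

open Graph public

IncidentTo : (G : Graph) → Fin (n G) → Fin (m G) → Set
IncidentTo G v e = proj₁ (ends G e) ≡ v ⊎ proj₂ (ends G e) ≡ v

incident? : (G : Graph) → (v : Fin (n G)) → (e : Fin (m G)) → Dec (IncidentTo G v e)
incident? G v e = (proj₁ (ends G e) ≟ v) ⊎-dec (proj₂ (ends G e) ≟ v)

ShareVertex : (G : Graph) → Fin (m G) → Fin (m G) → Set
ShareVertex G e e' = IncidentTo G (proj₁ (ends G e)) e' ⊎ IncidentTo G (proj₂ (ends G e)) e'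

-- F is a stable edge set of the spanning subgraph of G with edge set E,
-- w.r.t. the coloring ℓ (restricted to E).
Stable : (G : Graph) {C : Set} (ℓ : Fin (m G) → C) (E F : Subset (m G)) → Set
Stable G ℓ E F = F ⊆ E × (∀ e e' → e ∈ F → e' ∈ F → ShareVertex G e e' → ℓ e ≡ ℓ e')

HasStableSet : (G : Graph) {C : Set} (ℓ : Fin (m G) → C) (E : Subset (m G)) (k : ℕ) → Set
HasStableSet G ℓ E k = ∃[ F ] (Stable G ℓ E F × k ≤ ∣ F ∣)

incidentEdges : (G : Graph) → Fin (n G) → List (Fin (m G))
incidentEdges G v = filter (incident? G v) (allFin (m G))

chromDeg : (G : Graph) {C : Set} → DecidableEquality C → (ℓ : Fin (m G) → C) → Fin (n G) → ℕ
chromDeg G _≟C_ ℓ v = length (deduplicate _≟C_ (map ℓ (incidentEdges G v)))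

colorCount : (G : Graph) {C : Set} → DecidableEquality C → (ℓ : Fin (m G) → C) → Fin (n G) → C → ℕ
colorCount G _≟C_ ℓ v c = length (filter (λ e → ℓ e ≟C c) (incidentEdges G v))

AppearsAt : (G : Graph) {C : Set} (ℓ : Fin (m G) → C) → Fin (n G) → C → Set
AppearsAt G ℓ v c = ∃[ e ] (IncidentTo G v e × ℓ e ≡ c)

LeastFrequent : (G : Graph) {C : Set} → DecidableEquality C → (ℓ : Fin (m G) → C) → Fin (n G) → C → Set
LeastFrequent G _≟C_ ℓ v c =
  AppearsAt G ℓ v c × (∀ c' → AppearsAt G ℓ v c' → colorCount G _≟C_ ℓ v c ≤ colorCount G _≟C_ ℓ v c')

deleteEdges : (G : Graph) {C : Set} → DecidableEquality C → (ℓ : Fin (m G) → C) → Fin (n G) → C → Subset (m G)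
deleteEdges G _≟C_ ℓ v c = tabulate (λ e → not ⌊ incident? G v e ×-dec (ℓ e ≟C c) ⌋)

{-# OPTIONS --safe #-}
-- Let F be a stable set of size ≥ k. If F contains no edge of colour c at v it survives the
-- deletion. Otherwise all edges of F at v have colour c; let F₀ be the edges of F away from v.
-- If |F₀| ≥ k, F₀ itself works. If not, the at most 2|F₀| edges joining v to endpoints of F₀,
-- together with c, account for fewer than 2k + 1 colours at v, so some colour c' ≠ c at v
-- labels none of them. Then F₀ together with all edges of colour c' at v is stable, avoids the
-- deleted edges, and has size |F₀| + #c' ≥ |F₀| + #c ≥ |F|, as c is least frequent.
module Submission where

open import Defs
open import Level using (0ℓ)
open import Data.Nat using (ℕ; zero; suc; _≤_; _<_; _+_; _*_; _≤?_; z≤n; s≤s)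
open import Data.Nat.Properties
  using (<⇒≱; ≰⇒>; +-suc; *-suc; n<1+n; m≤m+n; +-mono-≤; +-monoʳ-≤; *-monoʳ-≤; module ≤-Reasoning)
open import Data.Fin using (Fin; zero; suc)
open import Data.Fin.Properties using (injective⇒≤; any?)
open import Data.Fin.Subset using (Subset; _∈_; ∣_∣; ⊤) renaming (_⊆_ to _⊆ˢ_)
open import Data.Fin.Subset.Properties using (∈⊤; p⊆q⇒∣p∣≤∣q∣) renaming (_∈?_ to _∈ˢ?_)
open import Data.Vec using (tabulate)
open import Data.Vec.Properties using (lookup∘tabulate; lookup⇒[]=; []=⇒lookup)
open import Data.Bool using (Bool; true; false; not)
open import Data.List using (List; []; _∷_; _++_; length; lookup; map; filter; deduplicate; allFin)
import Data.List as List
open import Data.List.Properties using (length-++)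
open import Data.List.Relation.Unary.All as All using (All; all?)
open import Data.List.Relation.Unary.All.Properties using (¬All⇒Any¬)
open import Data.List.Relation.Unary.Any using (here; there; index)
open import Data.List.Relation.Unary.Any.Properties using (lookup-index)
open import Data.List.Relation.Unary.Unique.Propositional using (Unique; _∷_)
open import Data.List.Relation.Unary.Unique.DecPropositional.Properties using (deduplicate-!)
open import Data.List.Relation.Binary.Subset.Propositional using (_⊆_)
open import Data.List.Membership.Propositional using (find) renaming (_∈_ to _∈ˡ_; _∉_ to _∉ˡ_)
open import Data.List.Membership.Propositional.Properties
  using (∈-lookup; ∈-map⁻; ∈-filter⁺; ∈-filter⁻; ∈-deduplicate⁻; ∈-allFin; ∈-++⁺ˡ; ∈-++⁺ʳ)
open import Data.Product using (_×_; _,_; proj₁; proj₂; ∃-syntax)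
open import Data.Sum using (_⊎_; inj₁; inj₂)
open import Data.Empty using (⊥-elim)
open import Function using (_∘_)
open import Function.Bundles using (_⇔_; mk⇔)
open import Function.Definitions using (Injective)
open import Relation.Nullary using (¬_; yes; no; does; contradiction)
open import Relation.Nullary.Decidable using (dec-true; dec-false; isYes≗does; _×-dec_)
open import Relation.Unary using (Pred; Decidable) renaming (_⊥_ to Disjoint)
open import Relation.Unary.Properties using (_∪?_; _∩?_; ∁?)
open import Relation.Binary.Definitions using (DecidableEquality)
open import Relation.Binary.PropositionalEquality
  using (_≡_; _≢_; refl; sym; trans; cong; subst; module ≡-Reasoning)

module _ {a} {A : Set a} where

  Unique-lookup-injective : ∀ {xs : List A} → Unique xs → Injective _≡_ _≡_ (lookup xs)
  Unique-lookup-injective (_ ∷ _) {zero} {zero} _ = refl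
  Unique-lookup-injective (x∉xs ∷ _) {zero} {suc j} eq = ⊥-elim (All.lookup x∉xs (∈-lookup j) eq)
  Unique-lookup-injective (x∉xs ∷ _) {suc i} {zero} eq = ⊥-elim (All.lookup x∉xs (∈-lookup i) (sym eq))
  Unique-lookup-injective (_ ∷ u) {suc i} {suc j} eq = cong suc (Unique-lookup-injective u eq)

  Unique∧⊆⇒length≤ : ∀ {xs ys : List A} → Unique xs → xs ⊆ ys → length xs ≤ length ys
  Unique∧⊆⇒length≤ {xs} {ys} u xs⊆ys = injective⇒≤ position-injective
    where
    open ≡-Reasoning
    position : Fin (length xs) → Fin (length ys)
    position i = index (xs⊆ys (∈-lookup i))
    position-injective : Injective _≡_ _≡_ position
    position-injective {i} {j} eq = Unique-lookup-injective u (begin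
      lookup xs i            ≡⟨ lookup-index (xs⊆ys (∈-lookup i)) ⟩
      lookup ys (position i) ≡⟨ cong (lookup ys) eq ⟩
      lookup ys (position j) ≡⟨ lookup-index (xs⊆ys (∈-lookup j)) ⟨
      lookup xs j            ∎)

module _ {a} {A : Set a} (_≟_ : DecidableEquality A) where
  open import Data.List.Membership.DecPropositional _≟_ using (_∈?_)

  pigeonhole : ∀ {xs ys : List A} → Unique xs → length ys < length xs → ∃[ x ] (x ∈ˡ xs × x ∉ˡ ys)
  pigeonhole {xs} {ys} u ys<xs with all? (_∈? ys) xs
  ... | yes xs⊆ys = contradiction (Unique∧⊆⇒length≤ u (All.lookup xs⊆ys)) (<⇒≱ ys<xs)
  ... | no xs⊈ys = find (¬All⇒Any¬ (_∈? ys) xs xs⊈ys)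

∈-tabulate⁺ : ∀ {n} (g : Fin n → Bool) {i} → g i ≡ true → i ∈ tabulate g
∈-tabulate⁺ g {i} gi = lookup⇒[]= i (tabulate g) (trans (lookup∘tabulate g i) gi)

∈-tabulate⁻ : ∀ {n} (g : Fin n → Bool) {i} → i ∈ tabulate g → g i ≡ true
∈-tabulate⁻ g {i} i∈ = trans (sym (lookup∘tabulate g i)) ([]=⇒lookup i∈)

module _ {p} {A : Set} {P : Pred A p} (P? : Decidable P) where

  length-filter-tabulate : ∀ {n} (f : Fin n → A) →
                           length (filter P? (List.tabulate f)) ≡ ∣ tabulate (does ∘ P? ∘ f) ∣
  length-filter-tabulate {zero} f = refl
  length-filter-tabulate {suc n} f with does (P? (f zero))
  ... | true  = cong suc (length-filter-tabulate (f ∘ suc))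
  ... | false = length-filter-tabulate (f ∘ suc)

toSubset : ∀ {n p} {P : Pred (Fin n) p} → Decidable P → Subset n
toSubset P? = tabulate (does ∘ P?)

module _ {n p} {P : Pred (Fin n) p} (P? : Decidable P) where

  ∈-toSubset⁺ : ∀ {i} → P i → i ∈ toSubset P?
  ∈-toSubset⁺ {i} Pi = ∈-tabulate⁺ (does ∘ P?) (dec-true (P? i) Pi)

  ∈-toSubset⁻ : ∀ {i} → i ∈ toSubset P? → P i
  ∈-toSubset⁻ {i} i∈ with P? i | ∈-tabulate⁻ (does ∘ P?) i∈
  ... | yes Pi | _ = Pi

  ∣toSubset∣≡length-filter : ∣ toSubset P? ∣ ≡ length (filter P? (allFin n))
  ∣toSubset∣≡length-filter = sym (length-filter-tabulate P? (λ i → i))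

∣toSubset-∪∣ : ∀ {n p q} {P : Pred (Fin n) p} {Q : Pred (Fin n) q} (P? : Decidable P) (Q? : Decidable Q) →
               Disjoint P Q → ∣ toSubset (P? ∪? Q?) ∣ ≡ ∣ toSubset P? ∣ + ∣ toSubset Q? ∣
∣toSubset-∪∣ {zero} P? Q? P⊥Q = refl
∣toSubset-∪∣ {suc n} P? Q? P⊥Q with P? zero | Q? zero | ∣toSubset-∪∣ (P? ∘ suc) (Q? ∘ suc) P⊥Q
... | yes P0 | yes Q0 | _  = ⊥-elim (P⊥Q (P0 , Q0))
... | yes _  | no _   | ih = cong suc ih
... | no _   | yes _  | ih = trans (cong suc ih) (sym (+-suc _ _))
... | no _   | no _   | ih = ih

module _ {p q} {A : Set} {P : Pred A p} {Q : Pred A q} (P? : Decidable P) (Q? : Decidable Q) where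

  filter-filter : ∀ xs → filter Q? (filter P? xs) ≡ filter (P? ∩? Q?) xs
  filter-filter [] = refl
  filter-filter (x ∷ xs) with P? x
  ... | no _ = filter-filter xs
  ... | yes _ with Q? x
  ...   | yes _ = cong (x ∷_) (filter-filter xs)
  ...   | no _  = filter-filter xs

module _ (G : Graph) where

  ShareVertex-sym : ∀ {e e'} → ShareVertex G e e' → ShareVertex G e' e
  ShareVertex-sym (inj₁ (inj₁ p)) = inj₁ (inj₁ (sym p))
  ShareVertex-sym (inj₁ (inj₂ p)) = inj₂ (inj₁ (sym p))
  ShareVertex-sym (inj₂ (inj₁ p)) = inj₁ (inj₂ (sym p))
  ShareVertex-sym (inj₂ (inj₂ p)) = inj₂ (inj₂ (sym p))

  incident-same⇒ShareVertex : ∀ {x e e'} → IncidentTo G x e → IncidentTo G x e' → ShareVertex G e e'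
  incident-same⇒ShareVertex {e' = e'} (inj₁ p) xe' = inj₁ (subst (λ w → IncidentTo G w e') (sym p) xe')
  incident-same⇒ShareVertex {e' = e'} (inj₂ p) xe' = inj₂ (subst (λ w → IncidentTo G w e') (sym p) xe')

  private
    Joins : Fin (n G) → Fin (n G) → Fin (m G) → Set
    Joins x y e = proj₁ (ends G e) ≡ x × proj₂ (ends G e) ≡ y

    joins-either-way : ∀ {x y e} → y ≢ x → IncidentTo G x e → IncidentTo G y e → Joins x y e ⊎ Joins y x e
    joins-either-way y≢x (inj₁ p) (inj₁ q) = ⊥-elim (y≢x (trans (sym q) p))
    joins-either-way y≢x (inj₁ p) (inj₂ q) = inj₁ (p , q)
    joins-either-way y≢x (inj₂ p) (inj₁ q) = inj₂ (q , p)
    joins-either-way y≢x (inj₂ p) (inj₂ q) = ⊥-elim (y≢x (trans (sym q) p))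

  incident-both⇒≡ : ∀ {x y e e'} → y ≢ x →
                    IncidentTo G x e → IncidentTo G y e → IncidentTo G x e' → IncidentTo G y e' → e ≡ e'
  incident-both⇒≡ {e = e} {e'} y≢x xe ye xe' ye'
    with joins-either-way y≢x xe ye | joins-either-way y≢x xe' ye'
  ... | inj₁ (p , q) | inj₁ (p' , q') = noParallel G e e' (inj₁ (trans p (sym p') , trans q (sym q')))
  ... | inj₁ (p , q) | inj₂ (p' , q') = noParallel G e e' (inj₂ (trans p (sym q') , trans q (sym p')))
  ... | inj₂ (p , q) | inj₁ (p' , q') = noParallel G e e' (inj₂ (trans p (sym q') , trans q (sym p')))
  ... | inj₂ (p , q) | inj₂ (p' , q') = noParallel G e e' (inj₁ (trans p (sym p') , trans q (sym q')))

module _ (G : Graph) {C : Set} (ℓ : Fin (m G) → C) (v : Fin (n G)) where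

  colourToward : Fin (n G) → List C
  colourToward x with any? (λ e → incident? G v e ×-dec incident? G x e)
  ... | yes (e , _) = ℓ e ∷ []
  ... | no _        = []

  length-colourToward : ∀ x → length (colourToward x) ≤ 1
  length-colourToward x with any? (λ e → incident? G v e ×-dec incident? G x e)
  ... | yes _ = s≤s z≤n
  ... | no _  = z≤n

  ∈-colourToward : ∀ {x e} → x ≢ v → IncidentTo G v e → IncidentTo G x e → ℓ e ∈ˡ colourToward x
  ∈-colourToward {x} x≢v ve xe with any? (λ e → incident? G v e ×-dec incident? G x e)
  ... | yes (e' , ve' , xe') = here (cong ℓ (incident-both⇒≡ G x≢v ve xe ve' xe'))
  ... | no none              = ⊥-elim (none (_ , ve , xe))

  linkColours : List (Fin (m G)) → List C
  linkColours []       = []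
  linkColours (f ∷ fs) =
    colourToward (proj₁ (ends G f)) ++ colourToward (proj₂ (ends G f)) ++ linkColours fs

  length-linkColours : ∀ fs → length (linkColours fs) ≤ 2 * length fs
  length-linkColours []       = z≤n
  length-linkColours (f ∷ fs) = begin
    length (linkColours (f ∷ fs))
      ≡⟨ length-++ (colourToward a) ⟩
    length (colourToward a) + length (colourToward b ++ linkColours fs)
      ≡⟨ cong (length (colourToward a) +_) (length-++ (colourToward b)) ⟩
    length (colourToward a) + (length (colourToward b) + length (linkColours fs))
      ≤⟨ +-mono-≤ (length-colourToward a) (+-mono-≤ (length-colourToward b) (length-linkColours fs)) ⟩
    2 + 2 * length fs
      ≡⟨ sym (*-suc 2 (length fs)) ⟩
    2 * length (f ∷ fs) ∎
    where
    open ≤-Reasoning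
    a = proj₁ (ends G f)
    b = proj₂ (ends G f)

  ∈-linkColours : ∀ {f fs e} → f ∈ˡ fs → ¬ IncidentTo G v f → IncidentTo G v e → ShareVertex G f e →
                  ℓ e ∈ˡ linkColours fs
  ∈-linkColours (here refl) v∉f ve (inj₁ ae) = ∈-++⁺ˡ (∈-colourToward (v∉f ∘ inj₁) ve ae)
  ∈-linkColours {f} (here refl) v∉f ve (inj₂ be) =
    ∈-++⁺ʳ (colourToward (proj₁ (ends G f))) (∈-++⁺ˡ (∈-colourToward (v∉f ∘ inj₂) ve be))
  ∈-linkColours {fs = f ∷ _} (there f∈fs) v∉f ve share =
    ∈-++⁺ʳ (colourToward (proj₁ (ends G f)))
      (∈-++⁺ʳ (colourToward (proj₂ (ends G f))) (∈-linkColours f∈fs v∉f ve share))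

module Reduction (G : Graph) {C : Set} (_≟C_ : DecidableEquality C) (ℓ : Fin (m G) → C)
                 (v : Fin (n G)) (c : C) where

  AtV : Pred (Fin (m G)) 0ℓ
  AtV = IncidentTo G v

  atV? : Decidable AtV
  atV? = incident? G v

  Coloured : C → Pred (Fin (m G)) 0ℓ
  Coloured c' e = ℓ e ≡ c'

  coloured? : ∀ c' → Decidable (Coloured c')
  coloured? c' e = ℓ e ≟C c'

  E' : Subset (m G)
  E' = deleteEdges G _≟C_ ℓ v c

  ∈-deleteEdges⁺ : ∀ {e} → ¬ (AtV e × Coloured c e) → e ∈ E'
  ∈-deleteEdges⁺ {e} kept =
    ∈-tabulate⁺ _ (cong not (trans (isYes≗does deletion?) (dec-false deletion? kept)))
    where deletion? = atV? e ×-dec coloured? c e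

  colorCount≡∣toSubset∣ : ∀ c' → colorCount G _≟C_ ℓ v c' ≡ ∣ toSubset (atV? ∩? coloured? c') ∣
  colorCount≡∣toSubset∣ c' = trans (cong length (filter-filter atV? (coloured? c') (allFin (m G))))
                                   (sym (∣toSubset∣≡length-filter (atV? ∩? coloured? c')))

  coloursAtV : List C
  coloursAtV = deduplicate _≟C_ (map ℓ (incidentEdges G v))

  ∈-coloursAtV⇒AppearsAt : ∀ {c'} → c' ∈ˡ coloursAtV → AppearsAt G ℓ v c'
  ∈-coloursAtV⇒AppearsAt c'∈ with ∈-map⁻ ℓ (∈-deduplicate⁻ _≟C_ (map ℓ (incidentEdges G v)) c'∈)
  ... | e , e∈ , refl = e , proj₂ (∈-filter⁻ atV? {xs = allFin (m G)} e∈) , refl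

  module _ (F : Subset (m G)) (F-stable : ∀ e e' → e ∈ F → e' ∈ F → ShareVertex G e e' → ℓ e ≡ ℓ e') where

    AwayFromV : Pred (Fin (m G)) 0ℓ
    AwayFromV e = e ∈ F × ¬ AtV e

    awayFromV? : Decidable AwayFromV
    awayFromV? = (_∈ˢ? F) ∩? ∁? atV?

    F₀ : Subset (m G)
    F₀ = toSubset awayFromV?

    F₀-stable : Stable G ℓ E' F₀
    F₀-stable = (λ e∈F₀ → ∈-deleteEdges⁺ (proj₂ (∈-toSubset⁻ awayFromV? e∈F₀) ∘ proj₁))
              , λ e e' e∈F₀ e'∈F₀ → F-stable e e' (proj₁ (∈-toSubset⁻ awayFromV? e∈F₀))
                                                  (proj₁ (∈-toSubset⁻ awayFromV? e'∈F₀))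

    recolour? : ∀ c' → Decidable (λ e → AwayFromV e ⊎ (AtV e × Coloured c' e))
    recolour? c' = awayFromV? ∪? (atV? ∩? coloured? c')

    recolour : C → Subset (m G)
    recolour c' = toSubset (recolour? c')

    ∣recolour∣ : ∀ c' → ∣ recolour c' ∣ ≡ ∣ F₀ ∣ + colorCount G _≟C_ ℓ v c'
    ∣recolour∣ c' = trans (∣toSubset-∪∣ awayFromV? (atV? ∩? coloured? c') (λ ((_ , ¬ve) , ve , _) → ¬ve ve))
                          (cong (∣ F₀ ∣ +_) (sym (colorCount≡∣toSubset∣ c')))

    ⊆-recolour : ∀ {e₀} → e₀ ∈ F → AtV e₀ → F ⊆ˢ recolour (ℓ e₀)
    ⊆-recolour {e₀} e₀∈F ve₀ {e} e∈F with atV? e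
    ... | no ¬ve = ∈-toSubset⁺ (recolour? (ℓ e₀)) (inj₁ (e∈F , ¬ve))
    ... | yes ve = ∈-toSubset⁺ (recolour? (ℓ e₀))
                     (inj₂ (ve , sym (F-stable e₀ e e₀∈F e∈F (incident-same⇒ShareVertex G ve₀ ve))))

    edgesOfF₀ : List (Fin (m G))
    edgesOfF₀ = filter awayFromV? (allFin (m G))

    linkColoursOfF₀ : List C
    linkColoursOfF₀ = linkColours G ℓ v edgesOfF₀

    recolour-stable : ∀ {c'} → c' ≢ c → c' ∉ˡ linkColoursOfF₀ → Stable G ℓ E' (recolour c')
    recolour-stable {c'} c'≢c c'∉ = recolour⊆E' , stable
      where
      recolour⊆E' : recolour c' ⊆ˢ E'
      recolour⊆E' e∈ with ∈-toSubset⁻ (recolour? c') e∈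
      ... | inj₁ (_ , ¬ve)   = ∈-deleteEdges⁺ (¬ve ∘ proj₁)
      ... | inj₂ (_ , ℓe≡c') = ∈-deleteEdges⁺ (λ (_ , ℓe≡c) → c'≢c (trans (sym ℓe≡c') ℓe≡c))

      noConflict : ∀ {e e'} → AwayFromV e → AtV e' × Coloured c' e' → ¬ ShareVertex G e e'
      noConflict {e} (e∈F , ¬ve) (ve' , ℓe'≡c') share =
        c'∉ (subst (_∈ˡ linkColoursOfF₀) ℓe'≡c'
          (∈-linkColours G ℓ v (∈-filter⁺ awayFromV? (∈-allFin e) (e∈F , ¬ve)) ¬ve ve' share))

      stable : ∀ e e' → e ∈ recolour c' → e' ∈ recolour c' → ShareVertex G e e' → ℓ e ≡ ℓ e'
      stable e e' e∈ e'∈ share with ∈-toSubset⁻ (recolour? c') e∈ | ∈-toSubset⁻ (recolour? c') e'∈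
      ... | inj₁ (e∈F , _) | inj₁ (e'∈F , _) = F-stable e e' e∈F e'∈F share
      ... | inj₂ (_ , ℓe≡c') | inj₂ (_ , ℓe'≡c') = trans ℓe≡c' (sym ℓe'≡c')
      ... | inj₁ away | inj₂ atV = ⊥-elim (noConflict away atV share)
      ... | inj₂ atV | inj₁ away = ⊥-elim (noConflict away atV (ShareVertex-sym G share))

    fresh-colour : ∀ {k} → suc ∣ F₀ ∣ ≤ k → 2 * k + 1 ≤ chromDeg G _≟C_ ℓ v →
                   ∃[ c' ] (AppearsAt G ℓ v c' × c' ≢ c × c' ∉ˡ linkColoursOfF₀)
    fresh-colour {k} F₀<k deg
      with pigeonhole _≟C_ (deduplicate-! _≟C_ (map ℓ (incidentEdges G v))) forbidden<
      where
      forbidden< : length (c ∷ linkColoursOfF₀) < length coloursAtV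
      forbidden< = begin-strict
        length (c ∷ linkColoursOfF₀) ≤⟨ s≤s (length-linkColours G ℓ v edgesOfF₀) ⟩
        suc (2 * length edgesOfF₀)   ≡⟨ cong (λ x → suc (2 * x)) (∣toSubset∣≡length-filter awayFromV?) ⟨
        suc (2 * ∣ F₀ ∣)             <⟨ n<1+n _ ⟩
        2 + 2 * ∣ F₀ ∣               ≡⟨ *-suc 2 ∣ F₀ ∣ ⟨
        2 * suc ∣ F₀ ∣               ≤⟨ *-monoʳ-≤ 2 F₀<k ⟩
        2 * k                        ≤⟨ m≤m+n (2 * k) 1 ⟩
        2 * k + 1                    ≤⟨ deg ⟩
        length coloursAtV            ∎
        where open ≤-Reasoning
    ... | c' , c'∈ , c'∉ = c' , ∈-coloursAtV⇒AppearsAt c'∈ , c'∉ ∘ here , c'∉ ∘ there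

    hasStableSet-E' : ∀ {k e₀} → 2 * k + 1 ≤ chromDeg G _≟C_ ℓ v →
                      (∀ c' → AppearsAt G ℓ v c' → colorCount G _≟C_ ℓ v c ≤ colorCount G _≟C_ ℓ v c') →
                      e₀ ∈ F → AtV e₀ → Coloured c e₀ → k ≤ ∣ F ∣ → HasStableSet G ℓ E' k
    hasStableSet-E' {k} {e₀} deg c-least e₀∈F ve₀ refl k≤∣F∣ with k ≤? ∣ F₀ ∣
    ... | yes k≤∣F₀∣ = F₀ , F₀-stable , k≤∣F₀∣
    ... | no k≰∣F₀∣ with fresh-colour (≰⇒> k≰∣F₀∣) deg
    ...   | c' , c'-appears , c'≢c , c'∉ = recolour c' , recolour-stable c'≢c c'∉ , (begin
      k                                    ≤⟨ k≤∣F∣ ⟩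
      ∣ F ∣                                ≤⟨ p⊆q⇒∣p∣≤∣q∣ (⊆-recolour e₀∈F ve₀) ⟩
      ∣ recolour c ∣                       ≡⟨ ∣recolour∣ c ⟩
      ∣ F₀ ∣ + colorCount G _≟C_ ℓ v c     ≤⟨ +-monoʳ-≤ ∣ F₀ ∣ (c-least c' c'-appears) ⟩
      ∣ F₀ ∣ + colorCount G _≟C_ ℓ v c'    ≡⟨ ∣recolour∣ c' ⟨
      ∣ recolour c' ∣                      ∎)
      where open ≤-Reasoning

lemma1 : (G : Graph) {C : Set} (_≟C_ : DecidableEquality C) (ℓ : Fin (m G) → C) (k : ℕ)
         (v : Fin (n G)) (c : C) →
         2 * k + 1 ≤ chromDeg G _≟C_ ℓ v →
         LeastFrequent G _≟C_ ℓ v c →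
         HasStableSet G ℓ ⊤ k ⇔ HasStableSet G ℓ (deleteEdges G _≟C_ ℓ v c) k
lemma1 G _≟C_ ℓ k v c deg (_ , c-least) = mk⇔ forward backward
  where
  open Reduction G _≟C_ ℓ v c

  forward : HasStableSet G ℓ ⊤ k → HasStableSet G ℓ E' k
  forward (F , (_ , F-stable) , k≤∣F∣) with any? (λ e → (e ∈ˢ? F) ×-dec (atV? e ×-dec coloured? c e))
  ... | no none = F , ((λ e∈F → ∈-deleteEdges⁺ (λ deleted → none (_ , e∈F , deleted))) , F-stable) , k≤∣F∣
  ... | yes (e₀ , e₀∈F , ve₀ , ℓe₀≡c) = hasStableSet-E' F F-stable deg c-least e₀∈F ve₀ ℓe₀≡c k≤∣F∣

  backward : HasStableSet G ℓ E' k → HasStableSet G ℓ ⊤ k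
  backward (F , (_ , F-stable) , k≤∣F∣) = F , ((λ _ → ∈⊤) , F-stable) , k≤∣F∣
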